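{- Let $G$ be a path of triangles graph with partition $X_1,\dots,X_{2n+1}$ and sets $L_{2i-1},M_{2i-1},R_{2i-1}$ as in the definition, where $n\ge 2$. Then $|M_3\cup L_3|\ge2$ and $|M_{2n-1}\cup R_{2n-1}|\ge 2$.
   Context: Sets $X,Y$ are complete (anticomplete) if every vertex of $X$ is adjacent (non-adjacent) to every vertex of $Y$; $X,Y$ are matched if $X\cap Y=\emptyset$, $|X|=|Y|$ and every vertex of $X$ has a unique neighbor in $Y$ and vice versa. $G$ is a path of triangles graph if for some integer $n\ge1$ there is a partition of $V(G)$ into stable sets $X_1,\dots,X_{2n+1}$ satisfying: P1: For $1\le i\le n$ there is a nonempty $\hat X_{2i}\subseteq X_{2i}$, and at least one of $\hat X_{2i},\hat X_{2i+2}$ has cardinality 1. P2: For $1\le i<j\le 2n+1$: (1) if $j-i\equiv2\pmod3$ and there are non-adjacent $u\in X_i$, $v\in X_j$, then either $i,j$ are odd and $j=i+2$, or $i,j$ are even and $u\notin\hat X_i$, $v\notin\hat X_j$; (2) if $j-i\not\equiv2\pmod 3$ then either $j=i+1$ or $X_i$ is anticomplete to $X_j$. P3: For $1\le i\le n+1$, $X_{2i-1}$ is the union of three pairwise disjoint sets $L_{2i-1},M_{2i-1},R_{2i-1}$. P4: For $1\le i\le n$, $X_{2i}$ is anticomplete to $L_{2i-1}\cup R_{2i+1}$; $X_{2i}\setminus\hat X_{2i}$ is anticomplete to $M_{2i-1}\cup M_{2i+1}$; every vertex of $X_{2i}\setminus\hat X_{2i}$ is adjacent to exactly one end of every edge between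 $R_{2i-1}$ and $L_{2i+1}$. P5: For $1\le i\le n$, if $|\hat X_{2i}|=1$ then (1) $R_{2i-1},L_{2i+1}$ are matched, and every edge between $M_{2i-1}\cup R_{2i-1}$ and $L_{2i+1}\cup M_{2i+1}$ is between $R_{2i-1}$ and $L_{2i+1}$; (2) the vertex of $\hat X_{2i}$ is complete to $R_{2i-1}\cup M_{2i-1}\cup L_{2i+1}\cup M_{2i+1}$; (3) $L_{2i-1}$ is complete to $X_{2i+1}$ and $X_{2i-1}$ is complete to $R_{2i+1}$; (4) if $i>1$, $M_{2i-1},\hat X_{2i-2}$ are matched, and if $i<n$, $M_{2i+1},\hat X_{2i+2}$ are matched. P6: For $1\le i\le n$, if $|\hat X_{2i}|>1$ then (1) $R_{2i-1}=L_{2i+1}=\emptyset$; (2) if $u\in X_{2i-1}$ and $v\in X_{2i+1}$, then $u,v$ are non-adjacent iff they have the same neighbor in $\hat X_{2i}$. P7: (1) $|\hat X_2|=|\hat X_{2n}|=1$; (2) $L_1=M_1=M_{2n+1}=R_{2n+1}=\emptyset$; (3) if $R_1=\emptyset$ then $n\ge2$ and $|\hat X_4|>1$, and if $L_{2n+1}=\emptyset$ then $n\ge2$ and $|\hat X_{2n-2}|>1$. -}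

module Defs where

open import Data.Nat using (ℕ; zero; suc; _+_; _*_; _∸_; _≤_; _<_; _>_)
open import Data.Nat.DivMod using (_%_)
open import Data.Fin using (Fin)
open import Data.Fin.Subset using (Subset; _∈_; _∉_; _∪_; ∣_∣)
open import Data.Product using (Σ; ∃; _×_; _,_)
open import Data.Sum using (_⊎_)
open import Data.Empty using (⊥)
open import Relation.Nullary using (¬_; Dec)
open import Relation.Binary.PropositionalEquality using (_≡_; _≢_)
open import Function.Bundles using (_⇔_)

record SimpleGraph : Set₁ where
  field
    N      : ℕ
    Adj    : Fin N → Fin N → Set
    sym    : ∀ {u v} → Adj u v → Adj v u
    irrefl : ∀ {u} → ¬ Adj u u
    dec    : ∀ u v → Dec (Adj u v)

module _ (G : SimpleGraph) where
  open SimpleGraph G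

  Vset : Set
  Vset = Subset N

  Stable : Vset → Set
  Stable A = ∀ u v → u ∈ A → v ∈ A → ¬ Adj u v

  Complete : Vset → Vset → Set
  Complete A B = ∀ u v → u ∈ A → v ∈ B → Adj u v

  Anticomplete : Vset → Vset → Set
  Anticomplete A B = ∀ u v → u ∈ A → v ∈ B → ¬ Adj u v

  Disjoint : Vset → Vset → Set
  Disjoint A B = ∀ v → v ∈ A → v ∈ B → ⊥

  Empty : Vset → Set
  Empty A = ∀ v → v ∉ A

  UniqueNbrs : Vset → Vset → Set
  UniqueNbrs A B = ∀ u → u ∈ A →
    Σ (Fin N) λ v → v ∈ B × Adj u v × (∀ w → w ∈ B → Adj u w → w ≡ v)

  Matched : Vset → Vset → Set
  Matched A B = Disjoint A B × ∣ A ∣ ≡ ∣ B ∣ × UniqueNbrs A B × UniqueNbrs B A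

  Odd Even : ℕ → Set
  Odd i = i % 2 ≡ 1
  Even i = i % 2 ≡ 0

  -- Path of triangles graph with parameter n and partition X_1,…,X_{2n+1}.
  -- All families are indexed by ℕ; only the indices named in the definition are constrained.
  record PathOfTriangles (n : ℕ) : Set where
    field
      X hatX L M R : ℕ → Vset
      n≥1 : 1 ≤ n
      cover   : ∀ v → Σ ℕ λ i → 1 ≤ i × i ≤ 2 * n + 1 × v ∈ X i
      unique  : ∀ v i j → 1 ≤ i → i ≤ 2 * n + 1 → 1 ≤ j → j ≤ 2 * n + 1 →
                v ∈ X i → v ∈ X j → i ≡ j
      stable  : ∀ i → 1 ≤ i → i ≤ 2 * n + 1 → Stable (X i)
      P1-sub  : ∀ i → 1 ≤ i → i ≤ n → ∀ v → v ∈ hatX (2 * i) → v ∈ X (2 * i)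
      P1-ne   : ∀ i → 1 ≤ i → i ≤ n → Σ (Fin N) λ v → v ∈ hatX (2 * i)
      P1-one  : ∀ i → 1 ≤ i → i < n →
                ∣ hatX (2 * i) ∣ ≡ 1 ⊎ ∣ hatX (2 * i + 2) ∣ ≡ 1
      P2-1    : ∀ i j → 1 ≤ i → i < j → j ≤ 2 * n + 1 → (j ∸ i) % 3 ≡ 2 →
                ∀ u v → u ∈ X i → v ∈ X j → ¬ Adj u v →
                (Odd i × Odd j × j ≡ i + 2) ⊎
                (Even i × Even j × u ∉ hatX i × v ∉ hatX j)
      P2-2    : ∀ i j → 1 ≤ i → i < j → j ≤ 2 * n + 1 → (j ∸ i) % 3 ≢ 2 →
                j ≡ i + 1 ⊎ Anticomplete (X i) (X j)
      P3-union : ∀ i → 1 ≤ i → i ≤ n + 1 →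
                 X (2 * i ∸ 1) ≡ L (2 * i ∸ 1) ∪ M (2 * i ∸ 1) ∪ R (2 * i ∸ 1)
      P3-LM   : ∀ i → 1 ≤ i → i ≤ n + 1 → Disjoint (L (2 * i ∸ 1)) (M (2 * i ∸ 1))
      P3-LR   : ∀ i → 1 ≤ i → i ≤ n + 1 → Disjoint (L (2 * i ∸ 1)) (R (2 * i ∸ 1))
      P3-MR   : ∀ i → 1 ≤ i → i ≤ n + 1 → Disjoint (M (2 * i ∸ 1)) (R (2 * i ∸ 1))
      P4-1    : ∀ i → 1 ≤ i → i ≤ n →
                Anticomplete (X (2 * i)) (L (2 * i ∸ 1) ∪ R (2 * i + 1))
      P4-2    : ∀ i → 1 ≤ i → i ≤ n → ∀ u v → u ∈ X (2 * i) → u ∉ hatX (2 * i) →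
                v ∈ M (2 * i ∸ 1) ∪ M (2 * i + 1) → ¬ Adj u v
      P4-3    : ∀ i → 1 ≤ i → i ≤ n → ∀ u → u ∈ X (2 * i) → u ∉ hatX (2 * i) →
                ∀ a b → a ∈ R (2 * i ∸ 1) → b ∈ L (2 * i + 1) → Adj a b →
                (Adj u a × ¬ Adj u b) ⊎ (¬ Adj u a × Adj u b)
      P5-1a   : ∀ i → 1 ≤ i → i ≤ n → ∣ hatX (2 * i) ∣ ≡ 1 →
                Matched (R (2 * i ∸ 1)) (L (2 * i + 1))
      P5-1b   : ∀ i → 1 ≤ i → i ≤ n → ∣ hatX (2 * i) ∣ ≡ 1 →
                ∀ a b → a ∈ M (2 * i ∸ 1) ∪ R (2 * i ∸ 1) → b ∈ L (2 * i + 1) ∪ M (2 * i + 1) →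
                Adj a b → a ∈ R (2 * i ∸ 1) × b ∈ L (2 * i + 1)
      P5-2    : ∀ i → 1 ≤ i → i ≤ n → ∣ hatX (2 * i) ∣ ≡ 1 →
                ∀ h → h ∈ hatX (2 * i) →
                ∀ v → v ∈ R (2 * i ∸ 1) ∪ M (2 * i ∸ 1) ∪ L (2 * i + 1) ∪ M (2 * i + 1) →
                Adj h v
      P5-3a   : ∀ i → 1 ≤ i → i ≤ n → ∣ hatX (2 * i) ∣ ≡ 1 →
                Complete (L (2 * i ∸ 1)) (X (2 * i + 1))
      P5-3b   : ∀ i → 1 ≤ i → i ≤ n → ∣ hatX (2 * i) ∣ ≡ 1 →
                Complete (X (2 * i ∸ 1)) (R (2 * i + 1))
      P5-4a   : ∀ i → 1 < i → i ≤ n → ∣ hatX (2 * i) ∣ ≡ 1 →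
                Matched (M (2 * i ∸ 1)) (hatX (2 * i ∸ 2))
      P5-4b   : ∀ i → 1 ≤ i → i < n → ∣ hatX (2 * i) ∣ ≡ 1 →
                Matched (M (2 * i + 1)) (hatX (2 * i + 2))
      P6-1a   : ∀ i → 1 ≤ i → i ≤ n → ∣ hatX (2 * i) ∣ > 1 → Empty (R (2 * i ∸ 1))
      P6-1b   : ∀ i → 1 ≤ i → i ≤ n → ∣ hatX (2 * i) ∣ > 1 → Empty (L (2 * i + 1))
      P6-2    : ∀ i → 1 ≤ i → i ≤ n → ∣ hatX (2 * i) ∣ > 1 →
                ∀ u v → u ∈ X (2 * i ∸ 1) → v ∈ X (2 * i + 1) →
                (¬ Adj u v) ⇔ (Σ (Fin N) λ w → w ∈ hatX (2 * i) × Adj u w × Adj v w)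
      P7-1a   : ∣ hatX 2 ∣ ≡ 1
      P7-1b   : ∣ hatX (2 * n) ∣ ≡ 1
      P7-2a   : Empty (L 1)
      P7-2b   : Empty (M 1)
      P7-2c   : Empty (M (2 * n + 1))
      P7-2d   : Empty (R (2 * n + 1))
      P7-3a   : Empty (R 1) → 2 ≤ n × ∣ hatX 4 ∣ > 1
      P7-3b   : Empty (L (2 * n + 1)) → 2 ≤ n × ∣ hatX (2 * n ∸ 2) ∣ > 1

{-# OPTIONS --safe #-}
-- M₃ is matched with X̂₄ (P5 at i = 1, as |X̂₂| = 1). If |X̂₄| > 1, then |M₃| = |X̂₄| ≥ 2;
-- otherwise P7 forces R₁ ≠ ∅, and the matching of R₁ with L₃ gives a vertex of L₃ besides
-- the one of M₃. The bound on M₂ₙ₋₁ ∪ R₂ₙ₋₁ is the mirror image.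
module Submission where

open import Defs
open import Data.Nat using (ℕ; _*_; _∸_; _≤_; _<_; s≤s; z≤n)
open import Data.Nat.Properties
  using (≤-trans; ≤-reflexive; ≤-refl; m≤m+n; m∸n≤m; ∸-monoˡ-≤; *-distribˡ-∸)
open import Data.Fin.Subset using (Subset; _∈_; _∉_; _⊂_; _∪_; ∣_∣; Nonempty)
open import Data.Fin.Subset.Properties
  using (p⊆p∪q; q⊆p∪q; ∣p∣≤∣p∪q∣; p⊂q⇒∣p∣<∣q∣; x∈p⇒∣p-x∣<∣p∣; nonempty?)
open import Data.Product using (_×_; _,_; proj₂)
open import Data.Sum using (_⊎_; inj₁; inj₂; map₂)
open import Function using (_∘_)
open import Relation.Nullary using (yes; no)
open import Relation.Binary.PropositionalEquality using (sym; subst)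

private
  variable
    k : ℕ
    p q : Subset k

Nonempty⇒0<∣p∣ : Nonempty p → 0 < ∣ p ∣
Nonempty⇒0<∣p∣ (_ , x∈p) = ≤-trans (s≤s z≤n) (x∈p⇒∣p-x∣<∣p∣ x∈p)

x∉p∧x∈q⇒p⊂p∪q : ∀ {x} → x ∉ p → x ∈ q → p ⊂ p ∪ q
x∉p∧x∈q⇒p⊂p∪q {p = p} {q} x∉p x∈q = p⊆p∪q q , _ , q⊆p∪q p q x∈q , x∉p

module VertexSets (G : SimpleGraph) where
  open SimpleGraph G using (N)

  private
    variable
      A B S : Subset N

  Disjoint-sym : Disjoint G A B → Disjoint G B A
  Disjoint-sym A∩B=∅ v v∈B v∈A = A∩B=∅ v v∈A v∈B

  Empty⇒P⇒P⊎Nonempty : ∀ {P : Set} → (Empty G A → P) → P ⊎ Nonempty A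
  Empty⇒P⇒P⊎Nonempty {A = A} f with nonempty? A
  ... | yes ne = inj₂ ne
  ... | no ¬ne = inj₁ (f λ v v∈A → ¬ne (v , v∈A))

  Disjoint∧Nonempty⇒2≤∣A∪B∣ : Disjoint G A B → Nonempty A → Nonempty B → 2 ≤ ∣ A ∪ B ∣
  Disjoint∧Nonempty⇒2≤∣A∪B∣ A∩B=∅ neA (b , b∈B) =
    ≤-trans (s≤s (Nonempty⇒0<∣p∣ neA))
            (p⊂q⇒∣p∣<∣q∣ (x∉p∧x∈q⇒p⊂p∪q (λ b∈A → A∩B=∅ b b∈A b∈B) b∈B))

  Matched⇒Nonemptyʳ : Matched G A B → Nonempty A → Nonempty B
  Matched⇒Nonemptyʳ (_ , _ , A→B , _) (a , a∈A) with A→B a a∈A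
  ... | b , b∈B , _ = b , b∈B

  Matched⇒Nonemptyˡ : Matched G A B → Nonempty B → Nonempty A
  Matched⇒Nonemptyˡ (_ , _ , _ , B→A) (b , b∈B) with B→A b b∈B
  ... | a , a∈A , _ = a , a∈A

  Matched∧Disjoint⇒2≤∣A∪S∣ : Matched G A B → Nonempty B → Disjoint G A S →
                             1 < ∣ B ∣ ⊎ Nonempty S → 2 ≤ ∣ A ∪ S ∣
  Matched∧Disjoint⇒2≤∣A∪S∣ {A = A} {S = S} (_ , ∣A∣≡∣B∣ , _) _ _ (inj₁ 1<∣B∣) =
    ≤-trans 1<∣B∣ (≤-trans (≤-reflexive (sym ∣A∣≡∣B∣)) (∣p∣≤∣p∪q∣ A S))
  Matched∧Disjoint⇒2≤∣A∪S∣ A~B neB A∩S=∅ (inj₂ neS) =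
    Disjoint∧Nonempty⇒2≤∣A∪B∣ A∩S=∅ (Matched⇒Nonemptyˡ A~B neB) neS

lemma3p3 : (G : SimpleGraph) (n : ℕ) (P : PathOfTriangles G n) → 2 ≤ n →
    let open PathOfTriangles P in
    2 ≤ ∣ M 3 ∪ L 3 ∣ × 2 ≤ ∣ M (2 * n ∸ 1) ∪ R (2 * n ∸ 1) ∣
lemma3p3 G n P 2≤n = left , right
  where
  open PathOfTriangles P
  open VertexSets G

  1≤n : 1 ≤ n
  1≤n = ≤-trans (s≤s z≤n) 2≤n

  left : 2 ≤ ∣ M 3 ∪ L 3 ∣
  left = Matched∧Disjoint⇒2≤∣A∪S∣ (P5-4b 1 ≤-refl 2≤n P7-1a) (P1-ne 2 (s≤s z≤n) 2≤n)
           (Disjoint-sym (P3-LM 2 (s≤s z≤n) (≤-trans 2≤n (m≤m+n n 1))))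
           (map₂ (Matched⇒Nonemptyʳ (P5-1a 1 ≤-refl 1≤n P7-1a))
                 (Empty⇒P⇒P⊎Nonempty (proj₂ ∘ P7-3a)))

  right : 2 ≤ ∣ M (2 * n ∸ 1) ∪ R (2 * n ∸ 1) ∣
  right = Matched∧Disjoint⇒2≤∣A∪S∣ (P5-4a n 2≤n ≤-refl P7-1b)
            (subst (Nonempty ∘ hatX) (*-distribˡ-∸ 2 n 1) (P1-ne (n ∸ 1) (∸-monoˡ-≤ 1 2≤n) (m∸n≤m n 1)))
            (P3-MR n 1≤n (m≤m+n n 1))
            (map₂ (Matched⇒Nonemptyˡ (P5-1a n 1≤n ≤-refl P7-1b))
                  (Empty⇒P⇒P⊎Nonempty (proj₂ ∘ P7-3b)))
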